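{- Let $A$ be a chromotopology whose color $n$ decomposes it, i.e. $V(A)=V_0\sqcup V_1$ where removing the color-$n$ edges leaves the two connected components $A_0$ (on $V_0$) and $A_1$ (on $V_1$), and $q_n$ restricts to a bijection $V_0\to V_1$. Let $h_0\colon V_0\to\mathbf{Z}$ and $h_1\colon V_1\to\mathbf{Z}$ be rank functions of $A_0$ and $A_1$ respectively, and let $h\colon V(A)\to\mathbf{Z}$ agree with $h_j$ on $V_j$. Then $h$ is a rank function of $A$ if and only if $|h_0(x)-h_1(q_n(x))|=1$ for every $x\in V_0$ such that $x$ is a sink of $A_0$ (with respect to $h_0$) or $q_n(x)$ is a sink of $A_1$ (with respect to $h_1$).
   Context: A chromotopology of dimension $n$ is a finite connected simple bipartite $n$-regular graph with edges colored by $[n]$, each vertex incident to exactly one edge of each color, such that for distinct colors $i,j$ the edges of colors $i,j$ form a disjoint union of $4$-cycles. $q_n(x)$ is the other endpoint of the color-$n$ edge at $x$. A rank function of a graph $G$ is a function $h\colon V(G)\to\mathbf{Z}$ with $|h(u)-h(w)|=1$ for every edge $\{u,w\}$ of $G$. A vertex is a sink (with respect to $h$) if all its neighbors in $G$ have strictly smaller $h$-value. -}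

module Defs where

open import Data.Nat using (ℕ; suc; _<_)
open import Data.Fin using (Fin; fromℕ)
open import Data.Bool using (Bool; true; false)
open import Data.Integer using (ℤ; _-_; ∣_∣) renaming (_<_ to _<ℤ_)
open import Data.Product using (Σ; ∃; ∃-syntax; _×_; _,_; proj₁; proj₂)
open import Relation.Binary.PropositionalEquality using (_≡_; _≢_)
open import Relation.Binary.Construct.Closure.ReflexiveTransitive using (Star)

record Graph : Set₁ where
  field
    Vertex : Set
    Adj    : Vertex → Vertex → Set

open Graph public

IsRankFunction : (G : Graph) → (Vertex G → ℤ) → Set
IsRankFunction G h = ∀ u w → Adj G u w → ∣ h u - h w ∣ ≡ 1

IsSink : (G : Graph) → (Vertex G → ℤ) → Vertex G → Set
IsSink G h u = ∀ w → Adj G u w → h w <ℤ h u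

Connected : Graph → Set
Connected G = ∀ u v → Star (Adj G) u v

-- The coloured edges are encoded by
-- q i x = the other endpoint of the colour-i edge at x.

record Chromotopology (n : ℕ) : Set where
  field
    m          : ℕ
    q          : Fin n → Fin m → Fin m
    -- colour-i edges form a perfect matching (each vertex on exactly one)
    involutive : ∀ i x → q i (q i x) ≡ x
    loopless   : ∀ i x → q i x ≢ x
    simple     : ∀ i j x → q i x ≡ q j x → i ≡ j
    nonempty   : 0 < m
    bipartite  : Σ (Fin m → Bool) (λ s → ∀ i x → s (q i x) ≢ s x)
    -- for distinct colours i, j the (i,j)-edges form disjoint 4-cycles
    squares    : ∀ i j x → i ≢ j → q i (q j (q i (q j x))) ≡ x

  graph : Graph
  graph = record { Vertex = Fin m ; Adj = λ x y → ∃[ i ] (q i x ≡ y) }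

  connectedField : Set
  connectedField = Connected graph

IsChromotopology : ∀ {n} → Chromotopology n → Set
IsChromotopology A = Chromotopology.connectedField A

module _ {k : ℕ} (A : Chromotopology (suc k)) where
  open Chromotopology A

  qn : Fin m → Fin m
  qn = q (fromℕ k)

  VSide : (Fin m → Bool) → Bool → Set
  VSide p b = Σ (Fin m) (λ x → p x ≡ b)

  subGraph : (Fin m → Bool) → Bool → Graph
  subGraph p b = record
    { Vertex = VSide p b
    ; Adj    = λ x y → ∃[ i ] (i ≢ fromℕ k × q i (proj₁ x) ≡ proj₁ y) }

  record Decomposition : Set where
    field
      side       : Fin m → Bool        -- false = V₀, true = V₁
      -- removing colour-n edges: no remaining edge joins V₀ and V₁ ...
      noCross    : ∀ i x → i ≢ fromℕ k → side (q i x) ≡ side x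
      -- ... and A₀, A₁ are connected (so they are the two components)
      conn₀      : Connected (subGraph side false)
      conn₁      : Connected (subGraph side true)
      qnInto     : ∀ x → side x ≡ false → side (qn x) ≡ true
      qnInj      : ∀ x y → side x ≡ false → side y ≡ false → qn x ≡ qn y → x ≡ y
      qnOnto     : ∀ y → side y ≡ true → ∃[ x ] (side x ≡ false × qn x ≡ y)

    V₀ V₁ : Set
    V₀ = VSide side false
    V₁ = VSide side true

    A₀ A₁ : Graph
    A₀ = subGraph side false
    A₁ = subGraph side true

    qn₀₁ : V₀ → V₁
    qn₀₁ (x , e) = qn x , qnInto x e

Fin-m : ∀ {n} → Chromotopology n → Set
Fin-m A = Fin (Chromotopology.m A)

-- Write δ x = h x − h (qₙ x).  Across an edge of colour i ≠ n both h x and h (qₙ x)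
-- move by ±1 (colours i and n span squares, so qₙ commutes with qᵢ), hence δ moves
-- by 0 or ±2: its parity is constant on the connected graph A₀.  A maximum of h on V₀
-- is a sink, where the hypothesis makes δ odd; so δ is odd everywhere.  If δ ≥ 2
-- somewhere, take such a vertex of maximal height: it is not a sink (there |δ| = 1),
-- but an ascending edge keeps δ ≥ 2 and increases h.  By the symmetry δ (qₙ x) = − δ x
-- the same excludes δ ≤ −2, so |δ| = 1 and h is a rank function across colour n too.
module Submission where

open import Defs
open import Data.Nat using (ℕ; suc; z≤n; s≤s)
import Data.Nat.Properties as ℕ
open import Data.Bool using (true; false)
open import Data.Bool.Properties using () renaming (_≟_ to _≟ᵇ_)
open import Data.Integer using (ℤ; +_; -[1+_]; _+_; _-_; -_; ∣_∣; _≤_; _<_; 1ℤ; -1ℤ; +≤+; NonNegative)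
  renaming (suc to sucℤ)
import Data.Integer.Properties as ℤ
open import Data.Integer.Tactic.RingSolver using (solve)
open import Data.Fin using (Fin; fromℕ; fromℕ<)
open import Data.Fin.Properties using (any?) renaming (_≟_ to _≟ᶠ_)
open import Data.List using (_∷_; []; filter; allFin)
open import Data.List.Extrema ℤ.≤-totalOrder using (argmax; argmax-all; f[xs]≤f[argmax])
open import Data.List.Membership.Propositional.Properties using (∈-filter⁺; ∈-allFin)
open import Data.List.Relation.Unary.All using (lookup)
open import Data.List.Relation.Unary.All.Properties using (all-filter)
open import Data.Product using (∃; _×_; _,_; proj₁)
open import Data.Sum using (_⊎_; inj₁; inj₂)
open import Data.Empty using (⊥-elim)
open import Function using (_∘_; id)
open import Function.Bundles using (_⇔_; mk⇔)
open import Relation.Nullary using (¬_; yes; no; contradiction)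
open import Relation.Nullary.Decidable using (_×-dec_; ¬?)
open import Relation.Unary using (Decidable)
open import Relation.Binary.PropositionalEquality
open import Relation.Binary.Construct.Closure.ReflexiveTransitive using (Star; ε; _◅_)

Even : ℤ → Set
Even i = ∃ λ j → i ≡ j + j

∣i∣≡1⇒i≡±1 : ∀ i → ∣ i ∣ ≡ 1 → i ≡ 1ℤ ⊎ i ≡ -1ℤ
∣i∣≡1⇒i≡±1 (+ 1)    refl = inj₁ refl
∣i∣≡1⇒i≡±1 -[1+ 0 ] refl = inj₂ refl

∣i∣≡1⇒i≱2 : ∀ {i} → ∣ i ∣ ≡ 1 → ¬ (+ 2 ≤ i)
∣i∣≡1⇒i≱2 {i} ∣i∣≡1 with ∣i∣≡1⇒i≡±1 i ∣i∣≡1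
... | inj₁ refl = λ { (+≤+ (s≤s ())) }
... | inj₂ refl = λ ()

even⇒∣i∣≢1 : ∀ {i} → Even i → ∣ i ∣ ≢ 1
even⇒∣i∣≢1 (+ 0 , refl) ()
even⇒∣i∣≢1 (+ suc n , refl) e =
  contradiction (trans (sym (ℕ.+-suc n n)) (ℕ.suc-injective e)) λ ()
even⇒∣i∣≢1 (-[1+ n ] , refl) ()

even-+ : ∀ {i j} → Even i → Even j → Even (i + j)
even-+ (a , refl) (b , refl) = a + b , solve (a ∷ b ∷ [])

even-neg : ∀ {i} → Even i → Even (- i)
even-neg (a , refl) = - a , ℤ.neg-distrib-+ a a

∣i∣≡1∧∣j∣≡1⇒even[i-j] : ∀ {i j} → ∣ i ∣ ≡ 1 → ∣ j ∣ ≡ 1 → Even (i - j)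
∣i∣≡1∧∣j∣≡1⇒even[i-j] {i} {j} ∣i∣≡1 ∣j∣≡1 with ∣i∣≡1⇒i≡±1 i ∣i∣≡1 | ∣i∣≡1⇒i≡±1 j ∣j∣≡1
... | inj₁ refl | inj₁ refl = + 0 , refl
... | inj₁ refl | inj₂ refl = 1ℤ , refl
... | inj₂ refl | inj₁ refl = -1ℤ , refl
... | inj₂ refl | inj₂ refl = + 0 , refl

even-shift : ∀ {a a′ b b′} → ∣ a - a′ ∣ ≡ 1 → ∣ b - b′ ∣ ≡ 1 →
             Even (a - b) → Even (a′ - b′)
even-shift {a} {a′} {b} {b′} ∣a-a′∣≡1 ∣b-b′∣≡1 even =
  subst Even regroup (even-+ even (∣i∣≡1∧∣j∣≡1⇒even[i-j] {b - b′} {a - a′} ∣b-b′∣≡1 ∣a-a′∣≡1))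
  where
  regroup : (a - b) + ((b - b′) - (a - a′)) ≡ a′ - b′
  regroup = solve (a ∷ a′ ∷ b ∷ b′ ∷ [])

∣j-k∣≡1⇒i-j≤1+i-k : ∀ i j k → ∣ j - k ∣ ≡ 1 → i - j ≤ (1ℤ + i) - k
∣j-k∣≡1⇒i-j≤1+i-k i j k ∣j-k∣≡1 = begin
  i - j                        ≤⟨ ℤ.i≤i+j (i - j) _ {{nonNegative}} ⟩
  (i - j) + (1ℤ + (j - k))     ≡⟨ solve (i ∷ j ∷ k ∷ []) ⟩
  (1ℤ + i) - k                 ∎
  where
  open ℤ.≤-Reasoning
  nonNegative : NonNegative (1ℤ + (j - k))
  nonNegative with ∣i∣≡1⇒i≡±1 (j - k) ∣j-k∣≡1
  ... | inj₁ j-k≡1  rewrite j-k≡1  = _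
  ... | inj₂ j-k≡-1 rewrite j-k≡-1 = _

∣i-j∣≡1∧j≢1+i⇒j<i : ∀ {i j} → ∣ i - j ∣ ≡ 1 → j ≢ sucℤ i → j < i
∣i-j∣≡1∧j≢1+i⇒j<i {i} {j} ∣i-j∣≡1 j≢1+i with ∣i∣≡1⇒i≡±1 (i - j) ∣i-j∣≡1
... | inj₁ i-j≡1 = ℤ.suc[i]≤j⇒i<j (ℤ.≤-reflexive (begin
  1ℤ + j        ≡⟨ cong (_+ j) i-j≡1 ⟨
  (i - j) + j   ≡⟨ solve (i ∷ j ∷ []) ⟩
  i             ∎))
  where open ≡-Reasoning
... | inj₂ i-j≡-1 = contradiction (begin
  j             ≡⟨ solve (i ∷ j ∷ []) ⟩
  i - (i - j)   ≡⟨ cong (_-_ i) i-j≡-1 ⟩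
  i + 1ℤ        ≡⟨ ℤ.+-comm i 1ℤ ⟩
  1ℤ + i        ∎) j≢1+i
  where open ≡-Reasoning

j-i≡-[i-j] : ∀ i j → j - i ≡ - (i - j)
j-i≡-[i-j] i j = solve (i ∷ j ∷ [])

1+i≰i : ∀ i → ¬ (sucℤ i ≤ i)
1+i≰i i = ℤ.i≮i ∘ ℤ.suc[i]≤j⇒i<j

odd∧i≱2∧-i≱2⇒∣i∣≡1 : ∀ {i} → ¬ Even i → ¬ (+ 2 ≤ i) → ¬ (+ 2 ≤ - i) → ∣ i ∣ ≡ 1
odd∧i≱2∧-i≱2⇒∣i∣≡1 {+ 0}             odd _    _     = ⊥-elim (odd (+ 0 , refl))
odd∧i≱2∧-i≱2⇒∣i∣≡1 {+ 1}             _   _    _     = refl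
odd∧i≱2∧-i≱2⇒∣i∣≡1 {+ suc (suc n)}   _   i≱2 _     = ⊥-elim (i≱2 (+≤+ (s≤s (s≤s z≤n))))
odd∧i≱2∧-i≱2⇒∣i∣≡1 { -[1+ 0 ]}       _   _    _     = refl
odd∧i≱2∧-i≱2⇒∣i∣≡1 { -[1+ suc n ]}   _   _    -i≱2 = ⊥-elim (-i≱2 (+≤+ (s≤s (s≤s z≤n))))

argmax-within : ∀ {n} {P : Fin n → Set} → Decidable P → (f : Fin n → ℤ) → ∃ P →
                ∃ λ x → P x × (∀ y → P y → f y ≤ f x)
argmax-within {n} P? f (x₀ , px₀) =
    argmax f x₀ candidates
  , argmax-all f px₀ (all-filter P? (allFin n))
  , λ y py → lookup (f[xs]≤f[argmax] x₀ candidates) (∈-filter⁺ P? (∈-allFin y) py)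
  where candidates = filter P? (allFin n)

module _ {k : ℕ} (A : Chromotopology (suc k)) where
  open Chromotopology A

  qn-commutes : ∀ i x → i ≢ fromℕ k → q i (qn A x) ≡ qn A (q i x)
  qn-commutes i x i≢n = begin
    q i (qn A x)                   ≡⟨ involutive (fromℕ k) _ ⟨
    qn A (qn A (q i (qn A x)))     ≡⟨ cong (qn A) (begin
      qn A (q i (qn A x))              ≡⟨ involutive i _ ⟨
      q i (q i (qn A (q i (qn A x))))  ≡⟨ cong (q i) (squares i (fromℕ k) x i≢n) ⟩
      q i x                            ∎) ⟩
    qn A (q i x)                   ∎
    where open ≡-Reasoning

  module _ (h : Fin m → ℤ) where

    δ : Fin m → ℤ
    δ x = h x - h (qn A x)

    IsLocalSink : Fin m → Set
    IsLocalSink x = ∀ i → i ≢ fromℕ k → h (q i x) < h x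

    Ascent : Fin m → Set
    Ascent x = ∃ λ i → i ≢ fromℕ k × h (q i x) ≡ sucℤ (h x)

    δ-qn : ∀ x → δ (qn A x) ≡ - δ x
    δ-qn x = begin
      h (qn A x) - h (qn A (qn A x)) ≡⟨ cong (λ y → h (qn A x) - h y) (involutive (fromℕ k) x) ⟩
      h (qn A x) - h x               ≡⟨ j-i≡-[i-j] (h x) (h (qn A x)) ⟩
      - δ x                          ∎
      where open ≡-Reasoning

module _ {k : ℕ} {A : Chromotopology (suc k)} (D : Decomposition A) where
  open Chromotopology A
  open Decomposition D

  side-qn-true : ∀ x → side x ≡ true → side (qn A x) ≡ false
  side-qn-true x x∈V₁ with qnOnto x x∈V₁
  ... | y , y∈V₀ , refl = subst (λ z → side z ≡ false) (sym (involutive (fromℕ k) y)) y∈V₀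

  vertex-in-V₀ : ∃ λ x → side x ≡ false
  vertex-in-V₀ with side (fromℕ< nonempty) in v-side
  ... | false = fromℕ< nonempty , v-side
  ... | true  = qn A (fromℕ< nonempty) , side-qn-true _ v-side

  module _ {b} {hᵇ : VSide A side b → ℤ} {h : Fin m → ℤ}
           (agree : ∀ x e → h x ≡ hᵇ (x , e)) where

    rank-off-last : IsRankFunction (subGraph A side b) hᵇ →
                    ∀ i x → side x ≡ b → i ≢ fromℕ k → ∣ h x - h (q i x) ∣ ≡ 1
    rank-off-last rank i x x∈b i≢n =
      subst₂ (λ u w → ∣ u - w ∣ ≡ 1) (sym (agree x x∈b)) (sym (agree (q i x) qix∈b))
        (rank (x , x∈b) (q i x , qix∈b) (i , i≢n , refl))
      where qix∈b = trans (noCross i x i≢n) x∈b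

    localSink⇒sink : ∀ x (x∈b : side x ≡ b) → IsLocalSink A h x →
                     IsSink (subGraph A side b) hᵇ (x , x∈b)
    localSink⇒sink x x∈b sink (y , y∈b) (i , i≢n , refl) =
      subst₂ _<_ (agree y y∈b) (agree x x∈b) (sink i i≢n)

  module _ {h : Fin m → ℤ} (h-step : ∀ i x → i ≢ fromℕ k → ∣ h x - h (q i x) ∣ ≡ 1) where

    ascent-or-localSink : ∀ x → Ascent A h x ⊎ IsLocalSink A h x
    ascent-or-localSink x
      with any? (λ i → ¬? (i ≟ᶠ fromℕ k) ×-dec (h (q i x) ℤ.≟ sucℤ (h x)))
    ... | yes ascent = inj₁ ascent
    ... | no ¬ascent = inj₂ λ i i≢n →
      ∣i-j∣≡1∧j≢1+i⇒j<i (h-step i x i≢n) (λ up → ¬ascent (i , i≢n , up))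

    localSink-within : ∀ {P : Fin m → Set} → Decidable P → ∃ P →
                       (∀ i x → i ≢ fromℕ k → P x → h (q i x) ≡ sucℤ (h x) → P (q i x)) →
                       ∃ λ s → P s × IsLocalSink A h s
    localSink-within P? ∃P ascent-closed with argmax-within P? h ∃P
    ... | s , ps , s-max with ascent-or-localSink s
    ...   | inj₂ sink = s , ps , sink
    ...   | inj₁ (i , i≢n , up) =
      ⊥-elim (1+i≰i (h s) (subst (_≤ h s) up (s-max (q i s) (ascent-closed i s i≢n ps up))))

    h-step-qn : ∀ i x → i ≢ fromℕ k → ∣ h (qn A x) - h (qn A (q i x)) ∣ ≡ 1
    h-step-qn i x i≢n =
      subst (λ y → ∣ h (qn A x) - h y ∣ ≡ 1) (qn-commutes A i x i≢n) (h-step i (qn A x) i≢n)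

    δ-parity-step : ∀ i x → i ≢ fromℕ k → Even (δ A h x) → Even (δ A h (q i x))
    δ-parity-step i x i≢n = even-shift {h x} {h (q i x)} (h-step i x i≢n) (h-step-qn i x i≢n)

    δ-parity-walk : ∀ {b u v} → Star (Adj (subGraph A side b)) u v →
                    Even (δ A h (proj₁ u)) → Even (δ A h (proj₁ v))
    δ-parity-walk ε = id
    δ-parity-walk {u = x , _} ((i , i≢n , refl) ◅ walk) =
      δ-parity-walk walk ∘ δ-parity-step i x i≢n

    δ-mono-ascent : ∀ i x → i ≢ fromℕ k → h (q i x) ≡ sucℤ (h x) → δ A h x ≤ δ A h (q i x)
    δ-mono-ascent i x i≢n up =
      subst (λ hy → δ A h x ≤ hy - h (qn A (q i x))) (sym up)
        (∣j-k∣≡1⇒i-j≤1+i-k (h x) (h (qn A x)) (h (qn A (q i x))) (h-step-qn i x i≢n))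

    module _ (sink-hyp : ∀ x → IsLocalSink A h x → ∣ δ A h x ∣ ≡ 1) where

      δ≱2 : ∀ x → ¬ (+ 2 ≤ δ A h x)
      δ≱2 x 2≤δx with localSink-within (λ y → + 2 ℤ.≤? δ A h y) (x , 2≤δx)
                        (λ i y i≢n 2≤δy up → ℤ.≤-trans 2≤δy (δ-mono-ascent i y i≢n up))
      ... | s , 2≤δs , sink = ∣i∣≡1⇒i≱2 (sink-hyp s sink) 2≤δs

      δ-odd-V₀ : ∀ x → side x ≡ false → ¬ Even (δ A h x)
      δ-odd-V₀ x x∈V₀ even with localSink-within (λ y → side y ≟ᵇ false) vertex-in-V₀
                                  (λ i y i≢n y∈V₀ _ → trans (noCross i y i≢n) y∈V₀)
      ... | s , s∈V₀ , sink =
        even⇒∣i∣≢1 (δ-parity-walk (conn₀ (x , x∈V₀) (s , s∈V₀)) even) (sink-hyp s sink)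

      δ-odd : ∀ x → ¬ Even (δ A h x)
      δ-odd x with side x in x-side
      ... | false = δ-odd-V₀ x x-side
      ... | true  = δ-odd-V₀ (qn A x) (side-qn-true x x-side)
                  ∘ subst Even (sym (δ-qn A h x)) ∘ even-neg

      ∣δ∣≡1 : ∀ x → ∣ δ A h x ∣ ≡ 1
      ∣δ∣≡1 x = odd∧i≱2∧-i≱2⇒∣i∣≡1 (δ-odd x) (δ≱2 x)
                  (δ≱2 (qn A x) ∘ subst (+ 2 ≤_) (sym (δ-qn A h x)))

      isRankFunction : IsRankFunction graph h
      isRankFunction x y (i , refl) with i ≟ᶠ fromℕ k
      ... | no i≢n   = h-step i x i≢n
      ... | yes refl = ∣δ∣≡1 x

  module _ {h₀ : V₀ → ℤ} {h₁ : V₁ → ℤ} {h : Fin m → ℤ}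
           (agree₀ : ∀ x e → h x ≡ h₀ (x , e)) (agree₁ : ∀ x e → h x ≡ h₁ (x , e)) where

    SinkCondition : Set
    SinkCondition = ∀ (x : V₀) → IsSink A₀ h₀ x ⊎ IsSink A₁ h₁ (qn₀₁ x) →
                    ∣ h₀ x - h₁ (qn₀₁ x) ∣ ≡ 1

    glued-step : IsRankFunction A₀ h₀ → IsRankFunction A₁ h₁ →
                 ∀ i x → i ≢ fromℕ k → ∣ h x - h (q i x) ∣ ≡ 1
    glued-step rank₀ rank₁ i x i≢n with side x in x-side
    ... | false = rank-off-last agree₀ rank₀ i x x-side i≢n
    ... | true  = rank-off-last agree₁ rank₁ i x x-side i≢n

    δ-as-glued : ∀ x (x∈V₀ : side x ≡ false) →
                 ∣ h₀ (x , x∈V₀) - h₁ (qn₀₁ (x , x∈V₀)) ∣ ≡ 1 → ∣ δ A h x ∣ ≡ 1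
    δ-as-glued x x∈V₀ =
      subst₂ (λ u w → ∣ u - w ∣ ≡ 1) (sym (agree₀ x x∈V₀)) (sym (agree₁ (qn A x) (qnInto x x∈V₀)))

    rank⇒sinkCondition : IsRankFunction graph h → SinkCondition
    rank⇒sinkCondition rank (x , x∈V₀) _ =
      subst₂ (λ u w → ∣ u - w ∣ ≡ 1) (agree₀ x x∈V₀) (agree₁ (qn A x) (qnInto x x∈V₀))
        (rank x (qn A x) (fromℕ k , refl))

    sinkCondition⇒localSinks : SinkCondition → ∀ x → IsLocalSink A h x → ∣ δ A h x ∣ ≡ 1
    sinkCondition⇒localSinks cond x sink with side x in x-side
    ... | false =
      δ-as-glued x x-side (cond (x , x-side) (inj₁ (localSink⇒sink agree₀ x x-side sink)))
    ... | true  = begin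
      ∣ δ A h x ∣           ≡⟨ ℤ.∣-i∣≡∣i∣ (δ A h x) ⟨
      ∣ - δ A h x ∣         ≡⟨ cong ∣_∣ (δ-qn A h x) ⟨
      ∣ δ A h (qn A x) ∣    ≡⟨ δ-as-glued (qn A x) x′∈V₀ (cond (qn A x , x′∈V₀) (inj₂ sink′)) ⟩
      1                     ∎
      where
      open ≡-Reasoning
      x′∈V₀ = side-qn-true x x-side
      sink′ = localSink⇒sink agree₁ _ _
                (subst (IsLocalSink A h) (sym (involutive (fromℕ k) x)) sink)

mainTheorem18 : (k : ℕ) (A : Chromotopology (suc k)) → IsChromotopology A →
    (D : Decomposition A) →
    let open Chromotopology A
        open Decomposition D
    in (h₀ : V₀ → ℤ) (h₁ : V₁ → ℤ) →
       IsRankFunction A₀ h₀ → IsRankFunction A₁ h₁ →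
       (h : Fin-m A → ℤ) →
       (∀ x e → h x ≡ h₀ (x , e)) → (∀ x e → h x ≡ h₁ (x , e)) →
       IsRankFunction graph h ⇔
       (∀ (x : V₀) → IsSink A₀ h₀ x ⊎ IsSink A₁ h₁ (qn₀₁ x) →
          ∣ h₀ x - h₁ (qn₀₁ x) ∣ ≡ 1)
mainTheorem18 k A _ D h₀ h₁ rank₀ rank₁ h agree₀ agree₁ =
  mk⇔ (rank⇒sinkCondition D agree₀ agree₁)
      (isRankFunction D (glued-step D agree₀ agree₁ rank₀ rank₁)
                        ∘ sinkCondition⇒localSinks D agree₀ agree₁)
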